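{- Let $\alpha=(0^{i_1},s_1,\ldots,0^{i_k},s_k)$ be a left weak composition ($i_p\geq0$, $s_p\geq1$) and let $a_p=i_1+s_1+\cdots+i_p+s_p$ for $p=0,1,\ldots,k$ (so $a_0=0$). Then $$\Gamma(P_\alpha)=\sum\ \prod_{p=1}^{k}\ \prod_{r=a_{p-1}+i_p+1}^{a_p}x_{n_r},$$ where the sum runs over all sequences $(n_1,\ldots,n_{a_k})$ of positive integers with $n_r\leq n_{r+1}$ for all $1\leq r<a_k$ and $n_r<n_{r+1}$ whenever $r\in\{a_1,\ldots,a_{k-1}\}$; that is, $\Gamma(P_\alpha)=\sum x_{n_1}^0\cdots x_{n_{i_1}}^0x_{n_{i_1+1}}\cdots x_{n_{a_1}}\cdots x^0_{n_{a_{k-1}+1}}\cdots x^0_{n_{a_{k-1}+i_k}}x_{n_{a_{k-1}+i_k+1}}\cdots x_{n_{a_k}}$ over $1\leq n_1\leq\cdots\leq n_{a_1}<n_{a_1+1}\leq\cdots<n_{a_{k-1}+1}\leq\cdots\leq n_{a_k}$.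
   Context: $x_1,x_2,\ldots$ are commuting variables; $0^i$ denotes $i$ zero entries; a left weak composition is a finite nonempty sequence of nonnegative integers ending in a positive entry. A labeled poset is a partial order $<_P$ on a set $P$ of positive integers (the labels); $<$ is the usual order. A $P$-partition is a map $f:P\to\mathbb{P}$ such that $a<_Pb$ implies $f(a)\leq f(b)$, and $a<_Pb$ together with $a>b$ implies $f(a)<f(b)$; $A(P)$ is the set of $P$-partitions. Construction of $P_\alpha$: take a chain (total order) on $N=a_k$ elements consisting of consecutive blocks $C_1,P_1,C_2,P_2,\ldots,C_k,P_k$ in this order along the chain, where $C_p$ has $i_p$ elements and $P_p$ has $s_p$ elements. Label it by $\{1,\ldots,N\}$ as follows: the elements of $C_1,C_2,\ldots,C_k$ receive the labels $1,2,\ldots,i_1+\cdots+i_k$ in increasing order along the chain; then the elements of $P_k$, then those of $P_{k-1}$, $\ldots$, then those of $P_1$ receive the subsequent labels, each block labeled increasingly along the chain. For $f\in A(P_\alpha)$ its weight is $w(f)=\prod_{q\in P_1\cup\cdots\cup P_k}x_{f(q)}$ (elements of the $C_p$ contribute $x_{f(q)}^0=1$), and $\Gamma(P_\alpha)=\sum_{f\in A(P_\alpha)}w(f)$. -}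

module Defs where

open import Data.Nat using (ℕ; zero; suc; _+_; _∸_; _≤_; _<_; _<ᵇ_; _≤ᵇ_; _≡ᵇ_)
open import Data.Bool using (Bool; true; false; if_then_else_; _∧_)
open import Data.List using (List; []; _∷_; map; filterᵇ; allFin)
open import Data.Bool.ListAction using (any)
open import Data.List.Relation.Unary.All using (All)
open import Data.List.Membership.Propositional using (_∈_)
open import Data.List.Relation.Binary.Permutation.Propositional using (_↭_)
open import Data.Fin using (Fin; toℕ)
open import Data.Product using (Σ; _×_; _,_; proj₁; proj₂)
open import Relation.Binary.PropositionalEquality using (_≡_; _≢_; _≗_)

-- Left weak compositions
-- α = (0^{i_1}, s_1, ..., 0^{i_k}, s_k) is encoded as the list of
-- blocks ((i_1 , s_1) ∷ ... ∷ (i_k , s_k) ∷ []).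

WComp : Set
WComp = List (ℕ × ℕ)

IsLeftWeakComp : WComp → Set
IsLeftWeakComp α = (α ≢ []) × All (λ b → 1 ≤ proj₂ b) α

total : WComp → ℕ
total [] = 0
total ((i , s) ∷ α) = i + s + total α

sumI : WComp → ℕ
sumI [] = 0
sumI ((i , s) ∷ α) = i + sumI α

sumS : WComp → ℕ
sumS [] = 0
sumS ((i , s) ∷ α) = s + sumS α

-- A labeled poset on the label set {1,...,n} is given by a relation on
-- Fin n; the element a : Fin n stands for the label (toℕ a + 1), so the
-- usual order of labels is the order of toℕ.

IsPPartition : {n : ℕ} → (Fin n → Fin n → Set) → (Fin n → ℕ) → Set
IsPPartition {n} _<P_ f =
  (∀ a → 1 ≤ f a)
  × (∀ a b → a <P b → f a ≤ f b)
  × (∀ a b → a <P b → toℕ b < toℕ a → f a < f b)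

-- The chain P_α.  Positions along the chain are 0,1,...,a_k - 1
-- (bottom to top); blocks C_1,P_1,...,C_k,P_k in this order.

-- label (a positive integer) of chain position r.
-- c = number of C-labels used so far, T = i_1+...+i_k.
labAux : ℕ → ℕ → WComp → ℕ → ℕ
labAux c T [] r = 0
labAux c T ((i , s) ∷ α) r =
  if r <ᵇ i then suc (c + r)
  else if r <ᵇ i + s then suc (T + sumS α + (r ∸ i))
  else labAux (c + i) T α (r ∸ (i + s))

chainLabel : WComp → ℕ → ℕ
chainLabel α r = labAux 0 (sumI α) α r

isPPos : WComp → ℕ → Bool
isPPos [] r = false
isPPos ((i , s) ∷ α) r =
  if r <ᵇ i then false
  else if r <ᵇ i + s then true
  else isPPos α (r ∸ (i + s))

PαLt : (α : WComp) → Fin (total α) → Fin (total α) → Set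
PαLt α a b =
  Σ (Fin (total α)) λ i → Σ (Fin (total α)) λ j →
    (toℕ i < toℕ j) × (chainLabel α (toℕ i) ≡ suc (toℕ a))
                    × (chainLabel α (toℕ j) ≡ suc (toℕ b))

isPLabel : (α : WComp) → Fin (total α) → Bool
isPLabel α a =
  any (λ i → isPPos α (toℕ i) ∧ (chainLabel α (toℕ i) ≡ᵇ suc (toℕ a)))
      (allFin (total α))

-- the weight w(f) = ∏_{q ∈ P_1 ∪ ... ∪ P_k} x_{f(q)}, represented by the
-- multiset (list up to permutation) of the indices f(q)
weightP : (α : WComp) → (Fin (total α) → ℕ) → List ℕ
weightP α f = map f (filterᵇ (isPLabel α) (allFin (total α)))

-- The right-hand side: sequences (n_1,...,n_{a_k}); the entry n_ρ is
-- n r with ρ = toℕ r + 1.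

-- the pairs (a_{p-1} + i_p , a_p), p = 1..k
bounds : ℕ → WComp → List (ℕ × ℕ)
bounds start [] = []
bounds start ((i , s) ∷ α) = (start + i , start + i + s) ∷ bounds (start + i + s) α

dropLast : {A : Set} → List A → List A
dropLast [] = []
dropLast (x ∷ []) = []
dropLast (x ∷ y ∷ xs) = x ∷ dropLast (y ∷ xs)

innerA : WComp → List ℕ
innerA α = dropLast (map proj₂ (bounds 0 α))

IsSeq : (α : WComp) → (Fin (total α) → ℕ) → Set
IsSeq α n =
  (∀ r → 1 ≤ n r)
  × (∀ r r′ → suc (toℕ r) ≡ toℕ r′ → n r ≤ n r′)
  × (∀ r r′ → suc (toℕ r) ≡ toℕ r′ → suc (toℕ r) ∈ innerA α → n r < n r′)

inWeightRange : (α : WComp) → Fin (total α) → Bool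
inWeightRange α r =
  any (λ b → (proj₁ b <ᵇ suc (toℕ r)) ∧ (suc (toℕ r) ≤ᵇ proj₂ b)) (bounds 0 α)

seqWeight : (α : WComp) → (Fin (total α) → ℕ) → List ℕ
seqWeight α n = map n (filterᵇ (inWeightRange α) (allFin (total α)))

-- Equality of the two generating functions means: for every monomial,
-- the sets of objects of that weight are in bijection.

record Equinumerous {N : ℕ} (A B : (Fin N → ℕ) → Set) : Set where
  field
    to      : (Fin N → ℕ) → (Fin N → ℕ)
    from    : (Fin N → ℕ) → (Fin N → ℕ)
    to-∈    : ∀ f → A f → B (to f)
    from-∈  : ∀ g → B g → A (from g)
    from∘to : ∀ f → A f → from (to f) ≗ f
    to∘from : ∀ g → B g → to (from g) ≗ g

-- coefficient sets of the monomial with index multiset m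
PPartsOfWeight : (α : WComp) → List ℕ → (Fin (total α) → ℕ) → Set
PPartsOfWeight α m f = IsPPartition (PαLt α) f × (weightP α f ↭ m)

SeqsOfWeight : (α : WComp) → List ℕ → (Fin (total α) → ℕ) → Set
SeqsOfWeight α m n = IsSeq α n × (seqWeight α n ↭ m)

module Submission where

-- Reading the chain from bottom to top is a bijection between chain positions and labels, and a
-- map on labels is a P_α-partition iff, read along the chain, it is weakly increasing and strictly
-- increasing across every descent of the labelling (a descent anywhere between two positions
-- already forces strictness between them, by transitivity). The C-blocks take the smallest labels
-- and each P-block takes labels above everything after it, so the descents sit exactly at the block
-- tops a_1, …, a_{k-1}, and the P-elements sit exactly at the positions a_{p-1}+i_p+1, …, a_p that
-- carry weight on the sequence side. Hence reading along the chain is a weight-preserving bijection.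

open import Defs
open import Data.Bool using (Bool; true; false; T; _∧_)
open import Data.Bool.Properties using (T-≡; T-∧)
open import Data.Bool.ListAction using (any)
open import Data.Empty using (⊥-elim)
open import Data.Fin using (Fin; toℕ; fromℕ<; punchOut)
open import Data.Fin.Properties
  using (toℕ-fromℕ<; toℕ<n; toℕ-injective; any?; punchOut-injective; injective⇒≤)
  renaming (_≟_ to _≟ᶠ_)
open import Data.List using (List; []; _∷_; map; filterᵇ; allFin)
open import Data.List.Properties using (map-∘; map-cong; filter-≐)
open import Data.List.Membership.Propositional using (_∈_; _∉_; lose)
open import Data.List.Membership.Propositional.Properties using (∈-map⁺; ∈-map⁻; ∈-allFin)
open import Data.List.Membership.Propositional.Properties.WithK using (unique∧set⇒bag)
open import Data.List.Relation.Binary.BagAndSetEquality using (∼bag⇒↭)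
open import Data.List.Relation.Binary.Permutation.Propositional using (_↭_; ↭-sym; ↭-trans; ↭-reflexive)
open import Data.List.Relation.Binary.Permutation.Propositional.Properties using (filter-↭; map⁺)
open import Data.List.Relation.Unary.All using (All; _∷_)
open import Data.List.Relation.Unary.Any using (here; there; satisfied)
open import Data.List.Relation.Unary.Any.Properties using (any⁺; any⁻)
open import Data.List.Relation.Unary.Unique.Propositional.Properties using (allFin⁺)
  renaming (map⁺ to unique-map⁺)
open import Data.Nat using (ℕ; zero; suc; _+_; _∸_; _≤_; _<_; _<ᵇ_; _≤ᵇ_; z≤n; s≤s; s<s; _<?_; >-nonZero)
open import Data.Nat.Properties
open import Data.Product using (_×_; _,_; proj₁; proj₂; ∃)
open import Data.Sum using (_⊎_; inj₁; inj₂)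
open import Function using (_∘_; _⇔_; mk⇔; Equivalence; Injective)
open import Relation.Nullary using (yes; no)
open import Relation.Nullary.Decidable using (T?)
open import Relation.Unary using (_≐_)
open import Algebra.Properties.CommutativeSemigroup +-commutativeSemigroup using (interchange)
open import Relation.Binary.PropositionalEquality

private
  variable
    A B : Set
    n : ℕ

dropLast-map : (f : A → B) (xs : List A) → dropLast (map f xs) ≡ map f (dropLast xs)
dropLast-map f []           = refl
dropLast-map f (x ∷ [])     = refl
dropLast-map f (x ∷ y ∷ xs) = cong (f x ∷_) (dropLast-map f (y ∷ xs))

map-filterᵇ : (f : A → B) (p : B → Bool) (xs : List A) →
              map f (filterᵇ (p ∘ f) xs) ≡ filterᵇ p (map f xs)
map-filterᵇ f p []       = refl
map-filterᵇ f p (x ∷ xs) with p (f x)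
... | true  = cong (f x ∷_) (map-filterᵇ f p xs)
... | false = map-filterᵇ f p xs

∈-map-+ : ∀ {k x xs} → k ≤ x → x ∈ map (k +_) xs ⇔ x ∸ k ∈ xs
∈-map-+ {k} {x} {xs} k≤x = mk⇔ to from
  where
  to : x ∈ map (k +_) xs → x ∸ k ∈ xs
  to x∈ with y , y∈ , refl ← ∈-map⁻ (k +_) x∈ = subst (_∈ xs) (sym (m+n∸m≡n k y)) y∈
  from : x ∸ k ∈ xs → x ∈ map (k +_) xs
  from x∸k∈ = subst (_∈ map (k +_) xs) (m+[n∸m]≡n k≤x) (∈-map⁺ (k +_) x∸k∈)

injective⇒surjective : (g : Fin n → Fin n) → Injective _≡_ _≡_ g → ∀ a → ∃ λ r → g r ≡ a
injective⇒surjective {zero}  g g-inj ()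
injective⇒surjective {suc n} g g-inj a with any? (λ r → g r ≟ᶠ a)
... | yes hit = hit
... | no miss = ⊥-elim (1+n≰n (injective⇒≤ squeezed-injective))
  where
  -- g misses a, so punching a out of its codomain injects Fin (suc n) into Fin n
  squeezed : Fin (suc n) → Fin n
  squeezed r = punchOut {i = a} {j = g r} (λ a≡gr → miss (r , sym a≡gr))
  squeezed-injective : Injective _≡_ _≡_ squeezed
  squeezed-injective {x} {y} =
    g-inj ∘ punchOut-injective (λ e → miss (x , sym e)) (λ e → miss (y , sym e))

map-allFin-↭ : (g : Fin n → Fin n) → Injective _≡_ _≡_ g → map g (allFin n) ↭ allFin n
map-allFin-↭ {n} g g-inj =
  ∼bag⇒↭ (unique∧set⇒bag (unique-map⁺ g-inj (allFin⁺ n)) (allFin⁺ n) (mk⇔ (λ _ → ∈-allFin _) hit))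
  where
  hit : ∀ {a} → a ∈ allFin n → a ∈ map g (allFin n)
  hit {a} _ with r , refl ← injective⇒surjective g g-inj a = ∈-map⁺ g (∈-allFin r)

adjacent-≤⇒monotone : (g : Fin n → ℕ) → (∀ r r′ → suc (toℕ r) ≡ toℕ r′ → g r ≤ g r′) →
                      ∀ i j → toℕ i ≤ toℕ j → g i ≤ g j
adjacent-≤⇒monotone {n} g step i j i≤j = go (toℕ j) j refl i≤j
  where
  go : ∀ k j → toℕ j ≡ k → toℕ i ≤ k → g i ≤ g j
  go k j j≡k i≤k with m≤n⇒m<n∨m≡n i≤k
  ... | inj₂ i≡k = ≤-reflexive (cong g (toℕ-injective (trans i≡k (sym j≡k))))
  go (suc k) j j≡k _ | inj₁ (s≤s i≤k) =
    ≤-trans (go k j′ (toℕ-fromℕ< k<n) i≤k) (step j′ j (trans (cong suc (toℕ-fromℕ< k<n)) (sym j≡k)))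
    where
    k<n : k < n
    k<n = <-trans (n<1+n k) (subst (_< n) j≡k (toℕ<n j))
    j′ : Fin n
    j′ = fromℕ< k<n

<ᵇ-true : ∀ {m n} → m < n → (m <ᵇ n) ≡ true
<ᵇ-true = Equivalence.to T-≡ ∘ <⇒<ᵇ

<ᵇ-false : ∀ {m n} → n ≤ m → (m <ᵇ n) ≡ false
<ᵇ-false {m} {n} n≤m with m <ᵇ n in eq
... | false = refl
... | true  = ⊥-elim (≤⇒≯ n≤m (<ᵇ⇒< m n (Equivalence.from T-≡ eq)))

m<n+o∧n≤m⇒m∸n<o : ∀ {k r M} → r < k + M → k ≤ r → r ∸ k < M
m<n+o∧n≤m⇒m∸n<o {k} {r} {M} r<k+M k≤r = subst (r ∸ k <_) (m+n∸m≡n k M) (∸-monoˡ-< r<k+M k≤r)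

tail-invariant : ∀ {c i I U} → c + (i + I) ≤ U → c + i + I ≤ U
tail-invariant {c} {i} {I} {U} = subst (_≤ U) (sym (+-assoc c i I))

data BlockPos (i s r : ℕ) : Set where
  inC    : r < i → BlockPos i s r
  inP    : i ≤ r → r < i + s → BlockPos i s r
  beyond : i + s ≤ r → BlockPos i s r

blockPos : ∀ i s r → BlockPos i s r
blockPos i s r with r <? i | r <? i + s
... | yes r<i | _       = inC r<i
... | no  r≮i | yes r<e = inP (≮⇒≥ r≮i) r<e
... | no  _   | no  r≮e = beyond (≮⇒≥ r≮e)

module HeadBlock (c U i s : ℕ) (α : WComp) where

  lab : ℕ → ℕ
  lab = labAux c U ((i , s) ∷ α)

  lab-inC : ∀ {r} → r < i → lab r ≡ suc (c + r)
  lab-inC r<i rewrite <ᵇ-true r<i = refl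

  lab-inP : ∀ {r} → i ≤ r → r < i + s → lab r ≡ suc (U + sumS α + (r ∸ i))
  lab-inP i≤r r<i+s rewrite <ᵇ-false i≤r | <ᵇ-true r<i+s = refl

  lab-beyond : ∀ {r} → i + s ≤ r → lab r ≡ labAux (c + i) U α (r ∸ (i + s))
  lab-beyond i+s≤r rewrite <ᵇ-false (≤-trans (m≤m+n i s) i+s≤r) | <ᵇ-false i+s≤r = refl

Between : ℕ → ℕ → ℕ → Set
Between lo hi l = lo < l × l ≤ hi

labAux-range : ∀ α c U r → r < total α → c + sumI α ≤ U →
               Between c (c + sumI α) (labAux c U α r) ⊎ Between U (U + sumS α) (labAux c U α r)
labAux-range ((i , s) ∷ α) c U r r<N inv = band (blockPos i s r)
  where
  open HeadBlock c U i s α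
  I S : ℕ
  I = sumI α
  S = sumS α
  band : BlockPos i s r → Between c (c + (i + I)) (lab r) ⊎ Between U (U + (s + S)) (lab r)
  band (inC r<i) rewrite lab-inC r<i =
    inj₁ (s≤s (m≤m+n c r) , +-monoʳ-< c (≤-trans r<i (m≤m+n i I)))
  band (inP i≤r r<i+s) rewrite lab-inP i≤r r<i+s =
    inj₂ (s≤s (≤-trans (m≤m+n U S) (m≤m+n _ _)) ,
          subst (U + S + (r ∸ i) <_) (trans (+-assoc U S s) (cong (U +_) (+-comm S s)))
                (+-monoʳ-< (U + S) (m<n+o∧n≤m⇒m∸n<o r<i+s i≤r)))
  band (beyond i+s≤r) rewrite lab-beyond i+s≤r
    with labAux-range α (c + i) U (r ∸ (i + s)) (m<n+o∧n≤m⇒m∸n<o r<N i+s≤r) (tail-invariant {c} {i} {I} inv)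
  ... | inj₁ (lo , hi) = inj₁ (≤-trans (s≤s (m≤m+n c i)) lo , ≤-trans hi (≤-reflexive (+-assoc c i I)))
  ... | inj₂ (lo , hi) = inj₂ (lo , ≤-trans hi (+-monoʳ-≤ U (m≤n+m S s)))

-- The labels of the head block's C-part, of the positions beyond the head block and of the
-- head block's P-part occupy three consecutive intervals, in this order.
module HeadBands (c U i s : ℕ) (α : WComp) (inv : c + (i + sumI α) ≤ U) where
  open HeadBlock c U i s α

  c+i≤U : c + i ≤ U
  c+i≤U = ≤-trans (+-monoʳ-≤ c (m≤m+n i (sumI α))) inv

  C-label≤ : ∀ {r} → r < i → lab r ≤ c + i
  C-label≤ r<i rewrite lab-inC r<i = +-monoʳ-< c r<i

  P-label> : ∀ {r} → i ≤ r → r < i + s → U + sumS α < lab r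
  P-label> {r} i≤r r<i+s rewrite lab-inP i≤r r<i+s = s≤s (m≤m+n (U + sumS α) (r ∸ i))

  beyond-label : ∀ {r} → i + s ≤ r → r < i + s + total α → c + i < lab r × lab r ≤ U + sumS α
  beyond-label {r} i+s≤r r<N rewrite lab-beyond i+s≤r
    with labAux-range α (c + i) U (r ∸ (i + s)) (m<n+o∧n≤m⇒m∸n<o r<N i+s≤r) (tail-invariant {c} {i} {sumI α} inv)
  ... | inj₁ (lo , hi) = lo , ≤-trans hi (≤-trans (tail-invariant {c} {i} {sumI α} inv) (m≤m+n U _))
  ... | inj₂ (lo , hi) = ≤-<-trans c+i≤U lo , hi

  C<P : ∀ {r r′} → r < i → i ≤ r′ → r′ < i + s → lab r < lab r′
  C<P r<i i≤r′ r′<i+s =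
    ≤-<-trans (≤-trans (C-label≤ r<i) (≤-trans c+i≤U (m≤m+n U (sumS α)))) (P-label> i≤r′ r′<i+s)

  C<beyond : ∀ {r r′} → r < i → i + s ≤ r′ → r′ < i + s + total α → lab r < lab r′
  C<beyond r<i i+s≤r′ r′<N = ≤-<-trans (C-label≤ r<i) (proj₁ (beyond-label i+s≤r′ r′<N))

  beyond<P : ∀ {r r′} → i + s ≤ r → r < i + s + total α → i ≤ r′ → r′ < i + s → lab r < lab r′
  beyond<P i+s≤r r<N i≤r′ r′<i+s = ≤-<-trans (proj₂ (beyond-label i+s≤r r<N)) (P-label> i≤r′ r′<i+s)

labAux-injective : ∀ α c U {r r′} → r < total α → r′ < total α → c + sumI α ≤ U →
                   labAux c U α r ≡ labAux c U α r′ → r ≡ r′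
labAux-injective ((i , s) ∷ α) c U {r} {r′} r<N r′<N inv eq = compare (blockPos i s r) (blockPos i s r′)
  where
  open HeadBlock c U i s α
  open HeadBands c U i s α inv
  compare : BlockPos i s r → BlockPos i s r′ → r ≡ r′
  compare (inC a)    (inC b)    =
    +-cancelˡ-≡ c _ _ (suc-injective (trans (sym (lab-inC a)) (trans eq (lab-inC b))))
  compare (inC a)    (inP b b′) = ⊥-elim (<⇒≢ (C<P a b b′) eq)
  compare (inC a)    (beyond b) = ⊥-elim (<⇒≢ (C<beyond a b r′<N) eq)
  compare (inP a a′) (inC b)    = ⊥-elim (>⇒≢ (C<P b a a′) eq)
  compare (inP a a′) (inP b b′) =
    ∸-cancelʳ-≡ a b (+-cancelˡ-≡ (U + sumS α) _ _
                       (suc-injective (trans (sym (lab-inP a a′)) (trans eq (lab-inP b b′)))))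
  compare (inP a a′) (beyond b) = ⊥-elim (>⇒≢ (beyond<P b r′<N a a′) eq)
  compare (beyond a) (inC b)    = ⊥-elim (>⇒≢ (C<beyond b a r<N) eq)
  compare (beyond a) (inP b b′) = ⊥-elim (<⇒≢ (beyond<P a r<N b b′) eq)
  compare (beyond a) (beyond b) =
    ∸-cancelʳ-≡ a b (labAux-injective α (c + i) U (m<n+o∧n≤m⇒m∸n<o r<N a) (m<n+o∧n≤m⇒m∸n<o r′<N b)
                       (tail-invariant {c} {i} {sumI α} inv)
                       (trans (sym (lab-beyond a)) (trans eq (lab-beyond b))))

bounds-tops-shift : ∀ α st u → map proj₂ (bounds (st + u) α) ≡ map (st +_) (map proj₂ (bounds u α))
bounds-tops-shift []            st u = refl
bounds-tops-shift ((i , s) ∷ α) st u =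
  cong₂ _∷_ st+top (trans (cong (λ z → map proj₂ (bounds z α)) st+top) (bounds-tops-shift α st (u + i + s)))
  where
  st+top : st + u + i + s ≡ st + (u + i + s)
  st+top = trans (cong (_+ s) (+-assoc st u i)) (+-assoc st (u + i) s)

innerA-cons : ∀ i s b β → innerA ((i , s) ∷ b ∷ β) ≡ i + s ∷ map (i + s +_) (innerA (b ∷ β))
innerA-cons i s b β = cong (i + s ∷_) (begin
  dropLast (map proj₂ (bounds (i + s) (b ∷ β)))
    ≡⟨ cong (λ z → dropLast (map proj₂ (bounds z (b ∷ β)))) (sym (+-identityʳ (i + s))) ⟩
  dropLast (map proj₂ (bounds (i + s + 0) (b ∷ β)))
    ≡⟨ cong dropLast (bounds-tops-shift (b ∷ β) (i + s) 0) ⟩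
  dropLast (map (i + s +_) (map proj₂ (bounds 0 (b ∷ β))))
    ≡⟨ dropLast-map (i + s +_) (map proj₂ (bounds 0 (b ∷ β))) ⟩
  map (i + s +_) (innerA (b ∷ β))
    ∎)
  where open ≡-Reasoning

innerA-≥ : ∀ i s β {x} → x ∈ innerA ((i , s) ∷ β) → i + s ≤ x
innerA-≥ i s []      ()
innerA-≥ i s (b ∷ β) {x} x∈ with subst (x ∈_) (innerA-cons i s b β) x∈
... | here refl = ≤-refl
... | there x∈′ with y , _ , refl ← ∈-map⁻ (i + s +_) x∈′ = m≤m+n (i + s) y

innerA-head : ∀ i s α → 0 < total α → i + s ∈ innerA ((i , s) ∷ α)
innerA-head i s (b ∷ β) _ = subst (i + s ∈_) (sym (innerA-cons i s b β)) (here refl)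

innerA-shift : ∀ i s α {t} → i + s ≤ t →
               suc t ∈ innerA ((i , s) ∷ α) ⇔ suc (t ∸ (i + s)) ∈ innerA α
innerA-shift i s []      _ = mk⇔ (λ ()) (λ ())
innerA-shift i s (b ∷ β) {t} k≤t = mk⇔ to from
  where
  k : ℕ
  k = i + s
  t+1∸k : suc t ∸ k ≡ suc (t ∸ k)
  t+1∸k = +-∸-assoc 1 k≤t
  to : suc t ∈ innerA ((i , s) ∷ b ∷ β) → suc (t ∸ k) ∈ innerA (b ∷ β)
  to m with subst (suc t ∈_) (innerA-cons i s b β) m
  ... | here t+1≡k = ⊥-elim (<⇒≢ (s≤s k≤t) (sym t+1≡k))
  ... | there m′   = subst (_∈ innerA (b ∷ β)) t+1∸k (Equivalence.to (∈-map-+ (m≤n⇒m≤1+n k≤t)) m′)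
  from : suc (t ∸ k) ∈ innerA (b ∷ β) → suc t ∈ innerA ((i , s) ∷ b ∷ β)
  from m = subst (suc t ∈_) (sym (innerA-cons i s b β))
             (there (Equivalence.from (∈-map-+ (m≤n⇒m≤1+n k≤t)) (subst (_∈ innerA (b ∷ β)) (sym t+1∸k) m)))

data LabelStep (α : WComp) (c U t : ℕ) : Set where
  descent : suc t ∈ innerA α → labAux c U α (suc t) < labAux c U α t → LabelStep α c U t
  ascent  : suc t ∉ innerA α → labAux c U α t < labAux c U α (suc t) → LabelStep α c U t

-- Each P-block carries larger labels than everything after it, so the labelling descends
-- exactly at the block tops a_p.
labelStep : ∀ α c U t → All (λ b → 1 ≤ proj₂ b) α → suc t < total α → c + sumI α ≤ U →
            LabelStep α c U t
labelStep ((i , s) ∷ α) c U t (1≤s ∷ positive) t+1<N inv = step (blockPos i s t) (blockPos i s (suc t))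
  where
  open HeadBlock c U i s α
  open HeadBands c U i s α inv

  lab-next : i + s ≤ t → lab (suc t) ≡ labAux (c + i) U α (suc (t ∸ (i + s)))
  lab-next i+s≤t = trans (lab-beyond (m≤n⇒m≤1+n i+s≤t)) (cong (labAux (c + i) U α) (+-∸-assoc 1 i+s≤t))

  not-inner : suc t < i + s → suc t ∉ innerA ((i , s) ∷ α)
  not-inner t+1<i+s t+1∈ = <⇒≱ t+1<i+s (innerA-≥ i s α t+1∈)

  step : BlockPos i s t → BlockPos i s (suc t) → LabelStep ((i , s) ∷ α) c U t
  step (inC a) (inC b) =
    ascent (not-inner (≤-trans b (m≤m+n i s)))
           (subst₂ _<_ (sym (lab-inC a)) (sym (lab-inC b)) (s<s (+-monoʳ-< c (n<1+n t))))
  step (inC a) (inP b b′) = ascent (not-inner b′) (C<P a b b′)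
  step (inC a) (beyond b) =
    ⊥-elim (<⇒≱ a (≤-pred (≤-trans (subst (_≤ i + s) (+-comm i 1) (+-monoʳ-≤ i 1≤s)) b)))
  step (inP a a′) (inC b) = ⊥-elim (<⇒≱ b (≤-trans a (n≤1+n t)))
  step (inP a a′) (inP b b′) =
    ascent (not-inner b′)
           (subst₂ _<_ (sym (lab-inP a a′)) (sym (lab-inP b b′))
                   (s<s (+-monoʳ-< (U + sumS α) (≤-reflexive (sym (+-∸-assoc 1 a))))))
  step (inP a a′) (beyond b) =
    descent (subst (_∈ innerA ((i , s) ∷ α)) (sym t+1≡i+s) (innerA-head i s α α-nonempty))
            (beyond<P b t+1<N a a′)
    where
    t+1≡i+s : suc t ≡ i + s
    t+1≡i+s = ≤-antisym a′ b
    α-nonempty : 0 < total α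
    α-nonempty = +-cancelˡ-< (i + s) 0 (total α)
                   (subst₂ _<_ (trans t+1≡i+s (sym (+-identityʳ (i + s)))) refl t+1<N)
  step (beyond a) (inC b)    = ⊥-elim (<⇒≱ b (≤-trans (m≤m+n i s) (≤-trans a (n≤1+n t))))
  step (beyond a) (inP b b′) = ⊥-elim (<⇒≱ b′ (≤-trans a (n≤1+n t)))
  step (beyond a) (beyond b)
    with labelStep α (c + i) U (t ∸ (i + s)) positive
                   (subst (_< total α) (+-∸-assoc 1 a) (m<n+o∧n≤m⇒m∸n<o t+1<N b))
                   (tail-invariant {c} {i} {sumI α} inv)
  ... | descent m lt =
    descent (Equivalence.from (innerA-shift i s α a) m) (subst₂ _<_ (sym (lab-next a)) (sym (lab-beyond a)) lt)
  ... | ascent m lt =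
    ascent (m ∘ Equivalence.to (innerA-shift i s α a)) (subst₂ _<_ (sym (lab-beyond a)) (sym (lab-next a)) lt)

module HeadBlockIsPPos (i s : ℕ) (α : WComp) where

  isPPos-inC : ∀ {r} → r < i → isPPos ((i , s) ∷ α) r ≡ false
  isPPos-inC r<i rewrite <ᵇ-true r<i = refl

  isPPos-inP : ∀ {r} → i ≤ r → r < i + s → isPPos ((i , s) ∷ α) r ≡ true
  isPPos-inP i≤r r<i+s rewrite <ᵇ-false i≤r | <ᵇ-true r<i+s = refl

  isPPos-beyond : ∀ {r} → i + s ≤ r → isPPos ((i , s) ∷ α) r ≡ isPPos α (r ∸ (i + s))
  isPPos-beyond i+s≤r rewrite <ᵇ-false (≤-trans (m≤m+n i s) i+s≤r) | <ᵇ-false i+s≤r = refl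

covers : ℕ → ℕ × ℕ → Bool
covers x (lo , hi) = (lo <ᵇ suc x) ∧ (suc x ≤ᵇ hi)

any-covers-below : ∀ α st x → x < st → any (covers x) (bounds st α) ≡ false
any-covers-below []            st x x<st = refl
any-covers-below ((i , s) ∷ α) st x x<st
  rewrite <ᵇ-false (≤-trans x<st (m≤m+n st i))
        | any-covers-below α (st + i + s) x (≤-trans x<st (≤-trans (m≤m+n st i) (m≤m+n (st + i) s)))
  = refl

any-covers : ∀ α st r → any (covers (st + r)) (bounds st α) ≡ isPPos α r
any-covers []            st r = refl
any-covers ((i , s) ∷ α) st r = kind (blockPos i s r)
  where
  open HeadBlockIsPPos i s α
  kind : BlockPos i s r → any (covers (st + r)) (bounds st ((i , s) ∷ α)) ≡ isPPos ((i , s) ∷ α) r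
  kind (inC r<i)
    rewrite <ᵇ-false (+-monoʳ-< st r<i)
          | any-covers-below α (st + i + s) (st + r) (≤-trans (+-monoʳ-< st r<i) (m≤m+n (st + i) s))
          | isPPos-inC r<i
    = refl
  kind (inP i≤r r<i+s)
    rewrite <ᵇ-true (s≤s (+-monoʳ-≤ st i≤r))
          | <ᵇ-true (subst (st + r <_) (sym (+-assoc st i s)) (+-monoʳ-< st r<i+s))
          | isPPos-inP i≤r r<i+s
    = refl
  kind (beyond i+s≤r)
    rewrite <ᵇ-true (s≤s (+-monoʳ-≤ st (≤-trans (m≤m+n i s) i+s≤r)))
          | <ᵇ-false (subst (_≤ st + r) (sym (+-assoc st i s)) (+-monoʳ-≤ st i+s≤r))
          | isPPos-beyond i+s≤r
          | sym (any-covers α (st + i + s) (r ∸ (i + s)))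
    = cong (λ x → any (covers x) (bounds (st + i + s) α)) st+r
    where
    st+r : st + r ≡ st + i + s + (r ∸ (i + s))
    st+r = trans (cong (st +_) (sym (m+[n∸m]≡n i+s≤r)))
                 (trans (sym (+-assoc st (i + s) _)) (cong (_+ (r ∸ (i + s))) (sym (+-assoc st i s))))

inWeightRange≡isPPos : ∀ α r → inWeightRange α r ≡ isPPos α (toℕ r)
inWeightRange≡isPPos α r = any-covers α 0 (toℕ r)

sumI+sumS≡total : ∀ α → sumI α + sumS α ≡ total α
sumI+sumS≡total []            = refl
sumI+sumS≡total ((i , s) ∷ α) =
  trans (interchange i (sumI α) s (sumS α)) (cong (i + s +_) (sumI+sumS≡total α))

module Labelling (α : WComp) (positive : All (λ b → 1 ≤ proj₂ b) α) where

  N : ℕ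
  N = total α

  label-bounds : ∀ {r} → r < N → 0 < chainLabel α r × chainLabel α r ≤ N
  label-bounds {r} r<N with labAux-range α 0 (sumI α) r r<N ≤-refl
  ... | inj₁ (lo , hi) = lo , ≤-trans hi (≤-trans (m≤m+n (sumI α) (sumS α)) (≤-reflexive (sumI+sumS≡total α)))
  ... | inj₂ (lo , hi) = ≤-<-trans z≤n lo , ≤-trans hi (≤-reflexive (sumI+sumS≡total α))

  labelOf : Fin N → Fin N
  labelOf r = fromℕ< (≤-trans (≤-reflexive (suc-pred _ {{>-nonZero lo}})) hi)
    where
    lo : 0 < chainLabel α (toℕ r)
    lo = proj₁ (label-bounds (toℕ<n r))
    hi : chainLabel α (toℕ r) ≤ N
    hi = proj₂ (label-bounds (toℕ<n r))

  labelOf-spec : ∀ r → chainLabel α (toℕ r) ≡ suc (toℕ (labelOf r))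
  labelOf-spec r = trans (sym (suc-pred _ {{>-nonZero (proj₁ (label-bounds (toℕ<n r)))}}))
                         (cong suc (sym (toℕ-fromℕ< _)))

  labelOf-injective : Injective _≡_ _≡_ labelOf
  labelOf-injective {r} {r′} e = toℕ-injective
    (labAux-injective α 0 (sumI α) (toℕ<n r) (toℕ<n r′) ≤-refl
      (trans (labelOf-spec r) (trans (cong (suc ∘ toℕ) e) (sym (labelOf-spec r′)))))

  positionOf : Fin N → Fin N
  positionOf a = proj₁ (injective⇒surjective labelOf labelOf-injective a)

  labelOf-positionOf : ∀ a → labelOf (positionOf a) ≡ a
  labelOf-positionOf a = proj₂ (injective⇒surjective labelOf labelOf-injective a)

  positionOf-labelOf : ∀ r → positionOf (labelOf r) ≡ r
  positionOf-labelOf r = labelOf-injective (labelOf-positionOf (labelOf r))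

  positionOf-unique : ∀ r a → chainLabel α (toℕ r) ≡ suc (toℕ a) → positionOf a ≡ r
  positionOf-unique r a e =
    trans (cong positionOf (toℕ-injective (suc-injective (trans (sym e) (labelOf-spec r)))))
          (positionOf-labelOf r)

  descent-between : ∀ i j → i < j → j < N → chainLabel α j < chainLabel α i →
                    ∃ λ t → i ≤ t × t < j × suc t ∈ innerA α
  descent-between i (suc j) i<j+1 j+1<N down with labelStep α 0 (sumI α) j positive j+1<N ≤-refl
  ... | descent j+1∈ _ = j , ≤-pred i<j+1 , n<1+n j , j+1∈
  ... | ascent _ up with m≤n⇒m<n∨m≡n (≤-pred i<j+1)
  ...   | inj₂ refl = ⊥-elim (<-asym up down)
  ...   | inj₁ i<j with t , i≤t , t<j , t+1∈ ← descent-between i j i<j (<-trans (n<1+n j) j+1<N) (<-trans up down)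
    = t , i≤t , <-trans t<j (n<1+n j) , t+1∈

  isPLabel-labelOf : ∀ r → T (isPLabel α (labelOf r)) ⇔ T (isPPos α (toℕ r))
  isPLabel-labelOf r = mk⇔ to from
    where
    to : T (isPLabel α (labelOf r)) → T (isPPos α (toℕ r))
    to hit with i , hitᵢ ← satisfied (any⁻ _ (allFin N) hit) with isP , same ← Equivalence.to T-∧ hitᵢ =
      subst (T ∘ isPPos α ∘ toℕ)
            (labelOf-injective (toℕ-injective (suc-injective
              (trans (sym (labelOf-spec i)) (≡ᵇ⇒≡ _ _ same)))))
            isP
    from : T (isPPos α (toℕ r)) → T (isPLabel α (labelOf r))
    from isP = any⁺ _ (lose (∈-allFin r) (Equivalence.from T-∧ (isP , ≡⇒≡ᵇ _ _ (labelOf-spec r))))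

  weight-labelOf : ∀ f → seqWeight α (f ∘ labelOf) ↭ weightP α f
  weight-labelOf f = ↭-trans (↭-reflexive reindex)
                             (map⁺ f (filter-↭ (T? ∘ isPLabel α) (map-allFin-↭ labelOf labelOf-injective)))
    where
    same-filter : (T ∘ inWeightRange α) ≐ (T ∘ isPLabel α ∘ labelOf)
    same-filter = (λ {r} w → Equivalence.from (isPLabel-labelOf r) (subst T (inWeightRange≡isPPos α r) w))
                , (λ {r} p → subst T (sym (inWeightRange≡isPPos α r)) (Equivalence.to (isPLabel-labelOf r) p))
    reindex : seqWeight α (f ∘ labelOf) ≡ map f (filterᵇ (isPLabel α) (map labelOf (allFin N)))
    reindex = begin
      map (f ∘ labelOf) (filterᵇ (inWeightRange α) (allFin N))
        ≡⟨ map-∘ _ ⟩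
      map f (map labelOf (filterᵇ (inWeightRange α) (allFin N)))
        ≡⟨ cong (map f ∘ map labelOf) (filter-≐ _ _ same-filter (allFin N)) ⟩
      map f (map labelOf (filterᵇ (isPLabel α ∘ labelOf) (allFin N)))
        ≡⟨ cong (map f) (map-filterᵇ labelOf (isPLabel α) (allFin N)) ⟩
      map f (filterᵇ (isPLabel α) (map labelOf (allFin N)))
        ∎
      where open ≡-Reasoning

  weight-positionOf : ∀ g → weightP α (g ∘ positionOf) ↭ seqWeight α g
  weight-positionOf g =
    ↭-trans (↭-sym (weight-labelOf (g ∘ positionOf)))
            (↭-reflexive (map-cong (cong g ∘ positionOf-labelOf) (filterᵇ (inWeightRange α) (allFin N))))

  ppartition⇒seq : ∀ f → IsPPartition (PαLt α) f → IsSeq α (f ∘ labelOf)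
  ppartition⇒seq f (pos , weak , strict) =
    pos ∘ labelOf , (λ r r′ e → weak _ _ (below (≤-reflexive e))) , strict-at-tops
    where
    below : ∀ {r r′} → toℕ r < toℕ r′ → PαLt α (labelOf r) (labelOf r′)
    below {r} {r′} r<r′ = r , r′ , r<r′ , labelOf-spec r , labelOf-spec r′
    strict-at-tops : ∀ r r′ → suc (toℕ r) ≡ toℕ r′ → suc (toℕ r) ∈ innerA α → f (labelOf r) < f (labelOf r′)
    strict-at-tops r r′ e r+1∈
      with labelStep α 0 (sumI α) (toℕ r) positive (subst (_< N) (sym e) (toℕ<n r′)) ≤-refl
    ... | ascent r+1∉ _ = ⊥-elim (r+1∉ r+1∈)
    ... | descent _ down =
      strict _ _ (below (≤-reflexive e))
             (≤-pred (subst₂ _<_ (trans (cong (chainLabel α) e) (labelOf-spec r′)) (labelOf-spec r) down))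

  seq⇒ppartition : ∀ g → IsSeq α g → IsPPartition (PαLt α) (g ∘ positionOf)
  seq⇒ppartition g (pos , step , strict) = pos ∘ positionOf , weak , strictP
    where
    monotone : ∀ i j → toℕ i ≤ toℕ j → g i ≤ g j
    monotone = adjacent-≤⇒monotone g step

    strict-across : ∀ i j t → toℕ i ≤ t → t < toℕ j → suc t ∈ innerA α → g i < g j
    strict-across i j t i≤t t<j t+1∈ =
      ≤-<-trans (monotone i t′ (subst (toℕ i ≤_) (sym (toℕ-fromℕ< _)) i≤t))
        (<-≤-trans (strict t′ t″ (trans (cong suc (toℕ-fromℕ< _)) (sym (toℕ-fromℕ< _)))
                           (subst (λ x → suc x ∈ innerA α) (sym (toℕ-fromℕ< _)) t+1∈))
                   (monotone t″ j (subst (_≤ toℕ j) (sym (toℕ-fromℕ< _)) t<j)))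
      where
      t′ t″ : Fin N
      t′ = fromℕ< (<-trans t<j (toℕ<n j))
      t″ = fromℕ< (≤-<-trans t<j (toℕ<n j))

    weak : ∀ a b → PαLt α a b → g (positionOf a) ≤ g (positionOf b)
    weak a b (i , j , i<j , lab-i , lab-j)
      rewrite positionOf-unique i a lab-i | positionOf-unique j b lab-j = monotone i j (<⇒≤ i<j)

    strictP : ∀ a b → PαLt α a b → toℕ b < toℕ a → g (positionOf a) < g (positionOf b)
    strictP a b (i , j , i<j , lab-i , lab-j) b<a
      rewrite positionOf-unique i a lab-i | positionOf-unique j b lab-j
      with t , i≤t , t<j , t+1∈ ← descent-between (toℕ i) (toℕ j) i<j (toℕ<n j)
                                    (subst₂ _<_ (sym lab-j) (sym lab-i) (s≤s b<a))
      = strict-across i j t i≤t t<j t+1∈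

lemma4p2 : (α : WComp) → IsLeftWeakComp α → (m : List ℕ) →
    Equinumerous (PPartsOfWeight α m) (SeqsOfWeight α m)
lemma4p2 α (_ , positive) m = record
  { to      = _∘ labelOf
  ; from    = _∘ positionOf
  ; to-∈    = λ f (isP , w) → ppartition⇒seq f isP , ↭-trans (weight-labelOf f) w
  ; from-∈  = λ g (isS , w) → seq⇒ppartition g isS , ↭-trans (weight-positionOf g) w
  ; from∘to = λ f _ → cong f ∘ labelOf-positionOf
  ; to∘from = λ g _ → cong g ∘ positionOf-labelOf
  }
  where open Labelling α positive
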